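{- The greedy algorithm achieves an approximation ratio of $\frac{e-1}{e+1}$ for Max Ext-Domination: for every undirected graph $G=(V,E)$ and integer $p$, the greedy output $A_p$ satisfies $ext(A_p)\geq \frac{e-1}{e+1}\max_{A\subseteq V,|A|=p} ext(A)$.
   Context: For $A\subseteq V$, $dom(A)$ is the number of vertices that are in $A$ or adjacent to some vertex of $A$, and $ext(A) = dom(A)-|A|$. Max Ext-Domination: given $G$ and $p$, find $A\subseteq V$ with $|A|=p$ maximizing $ext(A)$. The greedy algorithm sets $A_0=\emptyset$ and $A_{i+1} = A_i\cup\{\arg\max_{v\in V\setminus A_i} dom(A_i\cup\{v\})\}$ for $i<p$, returning $A_p$. -}

module Defs where

open import Data.Nat using (ℕ; zero; suc; _+_; _*_; _∸_; _≤_; _!)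
open import Data.Nat.Properties using (_!≢0)
open import Data.Bool using (Bool; true; false; _∨_; _∧_; T)
open import Data.Fin using (Fin)
open import Data.Fin.Subset using (Subset; ∣_∣; _∪_; ⁅_⁆; _∉_)
open import Data.Vec using (Vec; []; _∷_; lookup; tabulate)
open import Data.List using (List; []; _∷_)
open import Data.Rational using (ℚ; _/_)
import Data.Rational as ℚ
open import Relation.Binary.PropositionalEquality using (_≡_)
import Data.Integer as ℤ

record Graph (n : ℕ) : Set where
  field
    adj       : Fin n → Fin n → Bool
    symmetric : ∀ u v → adj u v ≡ adj v u
    irreflexive : ∀ v → adj v v ≡ false

open Graph public

anyFin : ∀ {n} → (Fin n → Bool) → Bool
anyFin {zero}  f = false
anyFin {suc n} f = f Fin.zero ∨ anyFin (λ i → f (Fin.suc i))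

closedNbhd : ∀ {n} → Graph n → Subset n → Subset n
closedNbhd G A = tabulate (λ v → lookup A v ∨ anyFin (λ u → lookup A u ∧ adj G u v))

dom : ∀ {n} → Graph n → Subset n → ℕ
dom G A = ∣ closedNbhd G A ∣

-- ext(A) = dom(A) - |A|   (dom(A) ≥ |A| always, so truncation never occurs)
ext : ∀ {n} → Graph n → Subset n → ℕ
ext G A = dom G A ∸ ∣ A ∣

toSubset : ∀ {n} → List (Fin n) → Subset n
toSubset []       = tabulate (λ _ → false)
toSubset (v ∷ vs) = ⁅ v ⁆ ∪ toSubset vs

-- A run of the greedy algorithm (arbitrary tie-breaking), recorded in
-- reverse order of selection: the list  vᵢ ∷ … ∷ v₁  with A_i = {v₁,…,vᵢ}.
data GreedyRun {n : ℕ} (G : Graph n) : List (Fin n) → Set where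
  start : GreedyRun G []
  step  : ∀ {vs} (v : Fin n) → GreedyRun G vs →
          v ∉ toSubset vs →
          (∀ (w : Fin n) → w ∉ toSubset vs →
             dom G (toSubset vs ∪ ⁅ w ⁆) ≤ dom G (toSubset vs ∪ ⁅ v ⁆)) →
          GreedyRun G (v ∷ vs)

ePartial : ℕ → ℚ
ePartial zero    = ℚ.1ℚ
ePartial (suc k) = ePartial k ℚ.+ (ℤ.+ 1 / (suc k !)) {{suc k !≢0}}

ℕ→ℚ : ℕ → ℚ
ℕ→ℚ m = ℤ.+ m / 1

-- "((e - 1)/(e + 1)) · x ≤ y" for naturals x, y (e = Euler's number).
-- For x, y ≥ 0 this is  e·(x - y) ≤ x + y, and since e = sup_k eₖ with
-- eₖ > 0 increasing, it holds iff  (eₖ - 1)·x ≤ (eₖ + 1)·y  for every k.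
eRatio*_≤_ : ℕ → ℕ → Set
eRatio* x ≤ y = ∀ k →
  (ePartial k ℚ.- ℚ.1ℚ) ℚ.* ℕ→ℚ x ℚ.≤ (ePartial k ℚ.+ ℚ.1ℚ) ℚ.* ℕ→ℚ y

module Submission where

-- Let A be any set of p = q + 1 vertices and d = dom A.  Since dom is a coverage function it is
-- submodular, so each greedy step from A_i gains at least (d − dom A_i)/p, which yields the classical
-- bound p^i (d − dom A_i) ≤ q^i d.  Combined with e_k q^p ≤ p^p, where e_k = Σ_{j≤k} 1/j!, this
-- gives e (d − g) ≤ d for g = dom A_p, and hence the ratio for ext = dom − p as soon as g ≥ 2p,
-- which holds while every greedy step gains at least two vertices.  If some step gains a single
-- vertex, then d ≤ dom A_i + p at that moment and ext A ≤ 2 ext A_p; if it gains none, A_i already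
-- dominates as much as A and ext A ≤ ext A_p.  Both suffice because e ≤ 3.

module EulerRatio where

  open import Data.Nat as ℕ using (ℕ; zero; suc; _!)
  open import Data.Nat.Properties as ℕP using (_!≢0)
  open import Data.Nat.Coprimality using (1-coprimeTo) renaming (sym to coprime-sym)
  open import Data.Integer as ℤ using (+_)
  import Data.Integer.Properties as ℤP
  open import Data.Rational using (ℚ; mkℚ; _/_; _+_; _*_; _-_; -_; _≤_; 0ℚ; 1ℚ; Positive; nonNegative)
  import Data.Rational.Properties as ℚP
  open import Data.Rational.Solver using (module +-*-Solver)
  open import Algebra.Bundles using (CommutativeRing)
  open import Algebra.Properties.CommutativeSemiring.Exp
    (CommutativeRing.commutativeSemiring ℚP.+-*-commutativeRing) using (_^_; ^-distrib-*)
  open import Relation.Binary.PropositionalEquality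
  open import Relation.Nullary using (yes; no)
  open import Defs using (ℕ→ℚ; ePartial; eRatio*_≤_)

  open +-*-Solver

  p≤p+q : ∀ p {q} → 0ℚ ≤ q → p ≤ p + q
  p≤p+q p 0≤q = ℚP.≤-trans (ℚP.≤-reflexive (sym (ℚP.+-identityʳ p))) (ℚP.+-monoʳ-≤ p 0≤q)

  *-monoˡ-≤-nonNeg′ : ∀ {p q} r → 0ℚ ≤ r → p ≤ q → r * p ≤ r * q
  *-monoˡ-≤-nonNeg′ r 0≤r = ℚP.*-monoˡ-≤-nonNeg r {{nonNegative 0≤r}}

  *-monoʳ-≤-nonNeg′ : ∀ {p q} r → 0ℚ ≤ r → p ≤ q → p * r ≤ q * r
  *-monoʳ-≤-nonNeg′ r 0≤r = ℚP.*-monoʳ-≤-nonNeg r {{nonNegative 0≤r}}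

  nonNeg*nonNeg⇒nonNeg′ : ∀ {p q} → 0ℚ ≤ p → 0ℚ ≤ q → 0ℚ ≤ p * q
  nonNeg*nonNeg⇒nonNeg′ {p} 0≤p 0≤q = ℚP.≤-trans (ℚP.≤-reflexive (sym (ℚP.*-zeroʳ p))) (*-monoˡ-≤-nonNeg′ p 0≤p 0≤q)

  p≤q⇒0≤q-p : ∀ {p q} → p ≤ q → 0ℚ ≤ q - p
  p≤q⇒0≤q-p {p} p≤q = ℚP.≤-trans (ℚP.≤-reflexive (sym (ℚP.+-inverseʳ p))) (ℚP.+-monoˡ-≤ (- p) p≤q)

  ^-nonNeg : ∀ {x} n → 0ℚ ≤ x → 0ℚ ≤ x ^ n
  ^-nonNeg zero    0≤x = ℚP.nonNegative⁻¹ 1ℚ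
  ^-nonNeg (suc n) 0≤x = nonNeg*nonNeg⇒nonNeg′ 0≤x (^-nonNeg n 0≤x)

  ^-mono-≤ : ∀ {x y} n → 0ℚ ≤ x → x ≤ y → x ^ n ≤ y ^ n
  ^-mono-≤ zero    0≤x x≤y = ℚP.≤-refl
  ^-mono-≤ {x} {y} (suc n) 0≤x x≤y = ℚP.≤-trans
    (*-monoʳ-≤-nonNeg′ (x ^ n) (^-nonNeg n 0≤x) x≤y)
    (*-monoˡ-≤-nonNeg′ y (ℚP.≤-trans 0≤x x≤y) (^-mono-≤ n 0≤x x≤y))

  -- ℕ→ℚ normalises by a gcd; rewriting with its normal form lets arithmetic on naturals compute.
  ℕ→ℚ-mkℚ : ∀ m → ℕ→ℚ m ≡ mkℚ (+ m) 0 (coprime-sym (1-coprimeTo m))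
  ℕ→ℚ-mkℚ m = ℚP.↥p/↧p≡p (mkℚ (+ m) 0 (coprime-sym (1-coprimeTo m)))

  ℕ→ℚ-+ : ∀ m n → ℕ→ℚ (m ℕ.+ n) ≡ ℕ→ℚ m + ℕ→ℚ n
  ℕ→ℚ-+ m n rewrite ℕ→ℚ-mkℚ m | ℕ→ℚ-mkℚ n =
    cong (_/ 1) (sym (trans (cong₂ ℤ._+_ (ℤP.*-identityʳ (+ m)) (ℤP.*-identityʳ (+ n))) (ℤP.pos-+ m n)))

  ℕ→ℚ-* : ∀ m n → ℕ→ℚ (m ℕ.* n) ≡ ℕ→ℚ m * ℕ→ℚ n
  ℕ→ℚ-* m n rewrite ℕ→ℚ-mkℚ m | ℕ→ℚ-mkℚ n = cong (_/ 1) (ℤP.pos-* m n)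

  ℕ→ℚ-^ : ∀ m n → ℕ→ℚ (m ℕ.^ n) ≡ ℕ→ℚ m ^ n
  ℕ→ℚ-^ m zero    = refl
  ℕ→ℚ-^ m (suc n) = trans (ℕ→ℚ-* m (m ℕ.^ n)) (cong (ℕ→ℚ m *_) (ℕ→ℚ-^ m n))

  ℕ→ℚ-nonNeg : ∀ m → 0ℚ ≤ ℕ→ℚ m
  ℕ→ℚ-nonNeg m rewrite ℕ→ℚ-mkℚ m = ℚP.nonNegative⁻¹ _

  ℕ→ℚ-pos : ∀ m .{{_ : ℕ.NonZero m}} → Positive (ℕ→ℚ m)
  ℕ→ℚ-pos (suc m) rewrite ℕ→ℚ-mkℚ (suc m) = _

  ℕ→ℚ-mono-≤ : ∀ {m n} → m ℕ.≤ n → ℕ→ℚ m ≤ ℕ→ℚ n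
  ℕ→ℚ-mono-≤ {m} {n} m≤n = begin
    ℕ→ℚ m                          ≤⟨ p≤p+q (ℕ→ℚ m) (ℕ→ℚ-nonNeg (n ℕ.∸ m)) ⟩
    ℕ→ℚ m + ℕ→ℚ (n ℕ.∸ m)          ≡⟨ ℕ→ℚ-+ m (n ℕ.∸ m) ⟨
    ℕ→ℚ (m ℕ.+ (n ℕ.∸ m))          ≡⟨ cong ℕ→ℚ (ℕP.m+[n∸m]≡n m≤n) ⟩
    ℕ→ℚ n                          ∎
    where open ℚP.≤-Reasoning

  ℕ→ℚ-*-inverse : ∀ n .{{_ : ℕ.NonZero n}} → ℕ→ℚ n * (+ 1 / n) ≡ 1ℚ
  ℕ→ℚ-*-inverse (suc m) =
    trans (cong₂ _*_ (ℕ→ℚ-mkℚ (suc m)) (ℚP.↥p/↧p≡p (mkℚ (+ 1) m (1-coprimeTo (suc m)))))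
          (ℚP.*-inverseʳ (mkℚ (+ suc m) 0 (coprime-sym (1-coprimeTo (suc m)))))

  invFactorial : ℕ → ℚ
  invFactorial j = (+ 1 / j !) {{j !≢0}}

  invFactorial-nonNeg : ∀ j → 0ℚ ≤ invFactorial j
  invFactorial-nonNeg j = ℚP.nonNegative⁻¹ (invFactorial j) {{ℚP.normalize-nonNeg 1 (j !) {{j !≢0}}}}

  ℕ→ℚ-*-invFactorial : ∀ j → ℕ→ℚ (j !) * invFactorial j ≡ 1ℚ
  ℕ→ℚ-*-invFactorial j = ℕ→ℚ-*-inverse (j !) {{j !≢0}}

  suc-*-invFactorial-suc : ∀ j → ℕ→ℚ (suc j) * invFactorial (suc j) ≡ invFactorial j
  suc-*-invFactorial-suc j = begin
    N * c′                 ≡⟨ ℚP.*-identityˡ (N * c′) ⟨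
    1ℚ * (N * c′)          ≡⟨ cong (_* (N * c′)) (ℕ→ℚ-*-invFactorial j) ⟨
    (F * c) * (N * c′)     ≡⟨ solve 4 (λ F c N c′ → (F :* c) :* (N :* c′) := c :* ((N :* F) :* c′)) refl F c N c′ ⟩
    c * ((N * F) * c′)     ≡⟨ cong (λ z → c * (z * c′)) (ℕ→ℚ-* (suc j) (j !)) ⟨
    c * (ℕ→ℚ (suc j !) * c′) ≡⟨ cong (c *_) (ℕ→ℚ-*-invFactorial (suc j)) ⟩
    c * 1ℚ                 ≡⟨ ℚP.*-identityʳ c ⟩
    c                      ∎
    where
    open ≡-Reasoning
    N = ℕ→ℚ (suc j); F = ℕ→ℚ (j !); c = invFactorial j; c′ = invFactorial (suc j)

  expTrunc : ℕ → ℚ → ℚ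
  expTrunc zero    x = 1ℚ
  expTrunc (suc k) x = expTrunc k x + invFactorial (suc k) * x ^ suc k

  1^n≡1 : ∀ n → 1ℚ ^ n ≡ 1ℚ
  1^n≡1 zero    = refl
  1^n≡1 (suc n) = trans (ℚP.*-identityˡ (1ℚ ^ n)) (1^n≡1 n)

  ePartial≡expTrunc-1 : ∀ k → ePartial k ≡ expTrunc k 1ℚ
  ePartial≡expTrunc-1 zero    = refl
  ePartial≡expTrunc-1 (suc k) = cong₂ _+_ (ePartial≡expTrunc-1 k)
    (trans (sym (ℚP.*-identityʳ (invFactorial (suc k)))) (cong (invFactorial (suc k) *_) (sym (1^n≡1 (suc k)))))

  expTrunc-≤-suc : ∀ k {x} → 0ℚ ≤ x → expTrunc k x ≤ expTrunc (suc k) x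
  expTrunc-≤-suc k {x} 0≤x =
    p≤p+q (expTrunc k x) (nonNeg*nonNeg⇒nonNeg′ (invFactorial-nonNeg (suc k)) (^-nonNeg (suc k) 0≤x))

  +-^-suc-≤ : ∀ {y t} j → 0ℚ ≤ y → 0ℚ ≤ t →
              (y + t) ^ suc j ≤ y ^ suc j + ℕ→ℚ (suc j) * t * (y + t) ^ j
  +-^-suc-≤ {y} {t} zero 0≤y 0≤t = ℚP.≤-reflexive
    (solve 2 (λ y t → (y :+ t) :* con 1ℚ := y :* con 1ℚ :+ con 1ℚ :* t :* con 1ℚ) refl y t)
  +-^-suc-≤ {y} {t} (suc j) 0≤y 0≤t = begin
    x * x ^ suc j
      ≤⟨ *-monoˡ-≤-nonNeg′ x 0≤x (+-^-suc-≤ j 0≤y 0≤t) ⟩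
    x * (y ^ suc j + N * t * x ^ j)
      ≡⟨ solve 5 (λ y t N P Q → (y :+ t) :* (P :+ N :* t :* Q) := y :* P :+ t :* P :+ N :* t :* ((y :+ t) :* Q))
           refl y t N (y ^ suc j) (x ^ j) ⟩
    y ^ suc (suc j) + t * y ^ suc j + N * t * x ^ suc j
      ≤⟨ ℚP.+-monoˡ-≤ (N * t * x ^ suc j)
           (ℚP.+-monoʳ-≤ (y ^ suc (suc j)) (*-monoˡ-≤-nonNeg′ t 0≤t (^-mono-≤ (suc j) 0≤y y≤x))) ⟩
    y ^ suc (suc j) + t * x ^ suc j + N * t * x ^ suc j
      ≡⟨ solve 4 (λ a t N R → a :+ t :* R :+ N :* t :* R := a :+ (con 1ℚ :+ N) :* t :* R)
           refl (y ^ suc (suc j)) t N (x ^ suc j) ⟩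
    y ^ suc (suc j) + (1ℚ + N) * t * x ^ suc j
      ≡⟨ cong (λ z → y ^ suc (suc j) + z * t * x ^ suc j) (ℕ→ℚ-+ 1 (suc j)) ⟨
    y ^ suc (suc j) + ℕ→ℚ (suc (suc j)) * t * x ^ suc j ∎
    where
    open ℚP.≤-Reasoning
    x = y + t
    N = ℕ→ℚ (suc j)
    0≤x : 0ℚ ≤ x
    0≤x = ℚP.+-mono-≤ 0≤y 0≤t
    y≤x : y ≤ x
    y≤x = p≤p+q y 0≤t

  -- A discrete mean-value inequality: the derivative of a truncated exponential is the shorter truncation.
  expTrunc-suc-+-≤ : ∀ {y t} k → 0ℚ ≤ y → 0ℚ ≤ t →
                     expTrunc (suc k) (y + t) ≤ expTrunc (suc k) y + t * expTrunc k (y + t)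
  expTrunc-suc-+-≤ {y} {t} zero 0≤y 0≤t = ℚP.≤-reflexive
    (solve 2 (λ y t → con 1ℚ :+ con 1ℚ :* ((y :+ t) :* con 1ℚ)
                     := (con 1ℚ :+ con 1ℚ :* (y :* con 1ℚ)) :+ t :* con 1ℚ) refl y t)
  expTrunc-suc-+-≤ {y} {t} (suc k) 0≤y 0≤t = begin
    expTrunc (suc k) x + c′ * x ^ suc (suc k)
      ≤⟨ ℚP.+-mono-≤ (expTrunc-suc-+-≤ k 0≤y 0≤t) (*-monoˡ-≤-nonNeg′ c′ (invFactorial-nonNeg (suc (suc k))) (+-^-suc-≤ (suc k) 0≤y 0≤t)) ⟩
    (expTrunc (suc k) y + t * expTrunc k x) + c′ * (y ^ suc (suc k) + N * t * x ^ suc k)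
      ≡⟨ solve 7 (λ E t M c′ P N Q → (E :+ t :* M) :+ c′ :* (P :+ N :* t :* Q)
                                    := (E :+ c′ :* P) :+ t :* (M :+ (N :* c′) :* Q))
           refl (expTrunc (suc k) y) t (expTrunc k x) c′ (y ^ suc (suc k)) N (x ^ suc k) ⟩
    expTrunc (suc (suc k)) y + t * (expTrunc k x + (N * c′) * x ^ suc k)
      ≡⟨ cong (λ z → expTrunc (suc (suc k)) y + t * (expTrunc k x + z * x ^ suc k)) (suc-*-invFactorial-suc (suc k)) ⟩
    expTrunc (suc (suc k)) y + t * expTrunc (suc k) x ∎
    where
    open ℚP.≤-Reasoning
    x = y + t
    N = ℕ→ℚ (suc (suc k))
    c′ = invFactorial (suc (suc k))

  expTrunc-+-≤ : ∀ {y t} k → 0ℚ ≤ y → 0ℚ ≤ t → expTrunc k (y + t) ≤ expTrunc k y + t * expTrunc k (y + t)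
  expTrunc-+-≤ {y} {t} zero 0≤y 0≤t = p≤p+q 1ℚ (nonNeg*nonNeg⇒nonNeg′ 0≤t (ℚP.nonNegative⁻¹ 1ℚ))
  expTrunc-+-≤ {y} {t} (suc k) 0≤y 0≤t = ℚP.≤-trans (expTrunc-suc-+-≤ k 0≤y 0≤t)
    (ℚP.+-monoʳ-≤ (expTrunc (suc k) y) (*-monoˡ-≤-nonNeg′ t 0≤t (expTrunc-≤-suc k (ℚP.+-mono-≤ 0≤y 0≤t))))

  ≤-+-*⇒*-1-≤ : ∀ {a b t} → a ≤ b + t * a → a * (1ℚ - t) ≤ b
  ≤-+-*⇒*-1-≤ {a} {b} {t} a≤b+ta = begin
    a * (1ℚ - t)        ≡⟨ solve 2 (λ a t → a :* (con 1ℚ :- t) := a :- t :* a) refl a t ⟩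
    a - t * a           ≤⟨ ℚP.+-monoˡ-≤ (- (t * a)) a≤b+ta ⟩
    b + t * a - t * a   ≡⟨ solve 2 (λ b u → b :+ u :- u := b) refl b (t * a) ⟩
    b                   ∎
    where open ℚP.≤-Reasoning

  expTrunc-+-*-1-≤ : ∀ {y t} k → 0ℚ ≤ y → 0ℚ ≤ t → expTrunc k (y + t) * (1ℚ - t) ≤ expTrunc k y
  expTrunc-+-*-1-≤ {t = t} k 0≤y 0≤t = ≤-+-*⇒*-1-≤ {t = t} (expTrunc-+-≤ k 0≤y 0≤t)

  expTrunc-0 : ∀ k → expTrunc k 0ℚ ≡ 1ℚ
  expTrunc-0 zero    = refl
  expTrunc-0 (suc k) = trans (cong (_+ invFactorial (suc k) * (0ℚ * 0ℚ ^ k)) (expTrunc-0 k))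
    (solve 2 (λ c P → con 1ℚ :+ c :* (con 0ℚ :* P) := con 1ℚ) refl (invFactorial (suc k)) (0ℚ ^ k))

  expTrunc-*-1-^-≤-1 : ∀ {t} k j → 0ℚ ≤ t → t ≤ 1ℚ → expTrunc k (ℕ→ℚ j * t) * (1ℚ - t) ^ j ≤ 1ℚ
  expTrunc-*-1-^-≤-1 {t} k zero 0≤t t≤1 = ℚP.≤-reflexive (begin
    expTrunc k (0ℚ * t) * 1ℚ ≡⟨ ℚP.*-identityʳ _ ⟩
    expTrunc k (0ℚ * t)      ≡⟨ cong (expTrunc k) (ℚP.*-zeroˡ t) ⟩
    expTrunc k 0ℚ            ≡⟨ expTrunc-0 k ⟩
    1ℚ                       ∎)
    where open ≡-Reasoning
  expTrunc-*-1-^-≤-1 {t} k (suc j) 0≤t t≤1 = begin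
    expTrunc k (ℕ→ℚ (suc j) * t) * (1ℚ - t) ^ suc j
      ≡⟨ cong (λ z → expTrunc k z * (1ℚ - t) ^ suc j) jt+t ⟩
    expTrunc k (s + t) * ((1ℚ - t) * (1ℚ - t) ^ j)
      ≡⟨ ℚP.*-assoc (expTrunc k (s + t)) (1ℚ - t) _ ⟨
    (expTrunc k (s + t) * (1ℚ - t)) * (1ℚ - t) ^ j
      ≤⟨ *-monoʳ-≤-nonNeg′ ((1ℚ - t) ^ j) (^-nonNeg j (p≤q⇒0≤q-p t≤1)) (expTrunc-+-*-1-≤ k 0≤s 0≤t) ⟩
    expTrunc k s * (1ℚ - t) ^ j
      ≤⟨ expTrunc-*-1-^-≤-1 k j 0≤t t≤1 ⟩
    1ℚ ∎
    where
    open ℚP.≤-Reasoning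
    s = ℕ→ℚ j * t
    jt+t : ℕ→ℚ (suc j) * t ≡ s + t
    jt+t = trans (cong (_* t) (ℕ→ℚ-+ 1 j)) (solve 2 (λ J t → (con 1ℚ :+ J) :* t := J :* t :+ t) refl (ℕ→ℚ j) t)
    0≤s : 0ℚ ≤ s
    0≤s = nonNeg*nonNeg⇒nonNeg′ (ℕ→ℚ-nonNeg j) 0≤t

  ePartial-*-^-≤ : ∀ k q → ePartial k * ℕ→ℚ (q ℕ.^ suc q) ≤ ℕ→ℚ (suc q ℕ.^ suc q)
  ePartial-*-^-≤ k q = begin
    ePartial k * ℕ→ℚ (q ℕ.^ p)
      ≡⟨ cong₂ _*_ (trans (ePartial≡expTrunc-1 k) (cong (expTrunc k) (sym P*t≡1))) (ℕ→ℚ-^ q p) ⟩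
    expTrunc k (P * t) * Q ^ p
      ≡⟨ cong (λ z → expTrunc k (P * t) * z ^ p) [1-t]*P≡Q ⟨
    expTrunc k (P * t) * ((1ℚ - t) * P) ^ p
      ≡⟨ cong (expTrunc k (P * t) *_) (^-distrib-* (1ℚ - t) P p) ⟩
    expTrunc k (P * t) * ((1ℚ - t) ^ p * P ^ p)
      ≡⟨ ℚP.*-assoc (expTrunc k (P * t)) _ _ ⟨
    (expTrunc k (P * t) * (1ℚ - t) ^ p) * P ^ p
      ≤⟨ *-monoʳ-≤-nonNeg′ (P ^ p) (^-nonNeg p (ℕ→ℚ-nonNeg p)) (expTrunc-*-1-^-≤-1 k p 0≤t t≤1) ⟩
    1ℚ * P ^ p
      ≡⟨ ℚP.*-identityˡ (P ^ p) ⟩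
    P ^ p
      ≡⟨ ℕ→ℚ-^ p p ⟨
    ℕ→ℚ (p ℕ.^ p) ∎
    where
    open ℚP.≤-Reasoning
    p = suc q
    P = ℕ→ℚ p
    Q = ℕ→ℚ q
    t = + 1 / p
    P*t≡1 : P * t ≡ 1ℚ
    P*t≡1 = ℕ→ℚ-*-inverse p
    0≤t : 0ℚ ≤ t
    0≤t = ℚP.nonNegative⁻¹ t {{ℚP.normalize-nonNeg 1 p}}
    t≤1 : t ≤ 1ℚ
    t≤1 = begin
      t          ≡⟨ ℚP.*-identityˡ t ⟨
      1ℚ * t     ≤⟨ *-monoʳ-≤-nonNeg′ t 0≤t (ℕ→ℚ-mono-≤ {1} {p} (ℕ.s≤s ℕ.z≤n)) ⟩
      P * t      ≡⟨ P*t≡1 ⟩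
      1ℚ         ∎
    [1-t]*P≡Q : (1ℚ - t) * P ≡ Q
    [1-t]*P≡Q = begin-equality
      (1ℚ - t) * P           ≡⟨ solve 2 (λ t P → (con 1ℚ :- t) :* P := P :- P :* t) refl t P ⟩
      P - P * t              ≡⟨ cong₂ _-_ (ℕ→ℚ-+ 1 q) P*t≡1 ⟩
      (1ℚ + Q) - 1ℚ          ≡⟨ solve 1 (λ Q → (con 1ℚ :+ Q) :- con 1ℚ := Q) refl Q ⟩
      Q                      ∎

  1≤ePartial : ∀ k → 1ℚ ≤ ePartial k
  1≤ePartial zero    = ℚP.≤-refl
  1≤ePartial (suc k) = ℚP.≤-trans (1≤ePartial k) (p≤p+q (ePartial k) (invFactorial-nonNeg (suc k)))

  -- 6^6 = 46656 ≤ 3 · 15625 = 3 · 5^6.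
  ePartial≤3 : ∀ k → ePartial k ≤ ℕ→ℚ 3
  ePartial≤3 k = ℚP.*-cancelʳ-≤-pos (ℕ→ℚ 15625)
    (ℚP.≤-trans (ePartial-*-^-≤ k 5) (ℚP.≤ᵇ⇒≤ _))

  ratio-of-≤-double : ∀ {e x y} → 1ℚ ≤ e → e ≤ ℕ→ℚ 3 → 0ℚ ≤ y → x ≤ y + y →
                      (e - 1ℚ) * x ≤ (e + 1ℚ) * y
  ratio-of-≤-double {e} {x} {y} 1≤e e≤3 0≤y x≤2y = begin
    (e - 1ℚ) * x                    ≤⟨ *-monoˡ-≤-nonNeg′ (e - 1ℚ) (p≤q⇒0≤q-p 1≤e) x≤2y ⟩
    (e - 1ℚ) * (y + y)              ≡⟨ solve 2 (λ e y → (e :- con 1ℚ) :* (y :+ y) := (e :+ con 1ℚ) :* y :- (con (ℕ→ℚ 3) :- e) :* y) refl e y ⟩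
    (e + 1ℚ) * y - (ℕ→ℚ 3 - e) * y  ≤⟨ ℚP.+-monoʳ-≤ ((e + 1ℚ) * y) (ℚP.neg-antimono-≤ (nonNeg*nonNeg⇒nonNeg′ (p≤q⇒0≤q-p e≤3) 0≤y)) ⟩
    (e + 1ℚ) * y - 0ℚ               ≡⟨ solve 1 (λ a → a :- con 0ℚ := a) refl ((e + 1ℚ) * y) ⟩
    (e + 1ℚ) * y                    ∎
    where open ℚP.≤-Reasoning

  *-≤-+-*-cancel : ∀ {e P Q d g} .{{_ : Positive P}} → 0ℚ ≤ e → 0ℚ ≤ d →
                   P * d ≤ Q * d + P * g → e * Q ≤ P → e * d ≤ d + e * g
  *-≤-+-*-cancel {e} {P} {Q} {d} {g} 0≤e 0≤d Pd≤Qd+Pg eQ≤P = ℚP.*-cancelˡ-≤-pos P (begin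
    P * (e * d)              ≡⟨ solve 3 (λ P e d → P :* (e :* d) := e :* (P :* d)) refl P e d ⟩
    e * (P * d)              ≤⟨ *-monoˡ-≤-nonNeg′ e 0≤e Pd≤Qd+Pg ⟩
    e * (Q * d + P * g)      ≡⟨ solve 5 (λ e Q d P g → e :* (Q :* d :+ P :* g) := (e :* Q) :* d :+ P :* (e :* g)) refl e Q d P g ⟩
    (e * Q) * d + P * (e * g) ≤⟨ ℚP.+-monoˡ-≤ (P * (e * g)) (*-monoʳ-≤-nonNeg′ d 0≤d eQ≤P) ⟩
    P * d + P * (e * g)      ≡⟨ ℚP.*-distribˡ-+ P d (e * g) ⟨
    P * (d + e * g)          ∎)
    where open ℚP.≤-Reasoning

  ratio-of-*-≤-+-* : ∀ {e p x y} → e * (p + x) ≤ (p + x) + e * (p + y) → p ≤ y →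
                     (e - 1ℚ) * x ≤ (e + 1ℚ) * y
  ratio-of-*-≤-+-* {e} {p} {x} {y} ed≤d+eg p≤y = begin
    (e - 1ℚ) * x                          ≡⟨ solve 3 (λ e p x → (e :- con 1ℚ) :* x := e :* (p :+ x) :- (x :+ e :* p)) refl e p x ⟩
    e * (p + x) - (x + e * p)             ≤⟨ ℚP.+-monoˡ-≤ (- (x + e * p)) ed≤d+eg ⟩
    (p + x) + e * (p + y) - (x + e * p)   ≡⟨ solve 4 (λ e p x y → (p :+ x) :+ e :* (p :+ y) :- (x :+ e :* p) := p :+ e :* y) refl e p x y ⟩
    p + e * y                             ≤⟨ ℚP.+-monoˡ-≤ (e * y) p≤y ⟩
    y + e * y                             ≡⟨ solve 2 (λ e y → y :+ e :* y := (e :+ con 1ℚ) :* y) refl e y ⟩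
    (e + 1ℚ) * y                          ∎
    where open ℚP.≤-Reasoning

  eRatio*-of-≤-double : ∀ {x y} → x ℕ.≤ y ℕ.+ y → eRatio* x ≤ y
  eRatio*-of-≤-double {x} {y} x≤2y k = ratio-of-≤-double (1≤ePartial k) (ePartial≤3 k) (ℕ→ℚ-nonNeg y)
    (subst (ℕ→ℚ x ≤_) (ℕ→ℚ-+ y y) (ℕ→ℚ-mono-≤ x≤2y))

  eRatio*-of-geometric : ∀ q {d g} → let p = suc q in
    p ℕ.^ p ℕ.* d ℕ.≤ q ℕ.^ p ℕ.* d ℕ.+ p ℕ.^ p ℕ.* g → p ℕ.+ p ℕ.≤ g → eRatio* (d ℕ.∸ p) ≤ (g ℕ.∸ p)
  eRatio*-of-geometric q {d} {g} Pd≤Qd+Pg 2p≤g with suc q ℕ.≤? d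
  ... | no  p≰d rewrite ℕP.m≤n⇒m∸n≡0 (ℕP.<⇒≤ (ℕP.≰⇒> p≰d)) = eRatio*-of-≤-double {y = g ℕ.∸ suc q} ℕ.z≤n
  ... | yes p≤d = λ k → ratio-of-*-≤-+-* {ePartial k} {ℕ→ℚ p} {ℕ→ℚ (d ℕ.∸ p)} {ℕ→ℚ (g ℕ.∸ p)}
    (subst₂ (λ d′ g′ → ePartial k * d′ ≤ d′ + ePartial k * g′) (split p≤d) (split p≤g) (ed≤d+eg k))
    (ℕ→ℚ-mono-≤ (ℕP.m+n≤o⇒m≤o∸n p 2p≤g))
    where
    p = suc q
    p≤g : p ℕ.≤ g
    p≤g = ℕP.≤-trans (ℕP.m≤m+n p p) 2p≤g
    split : ∀ {m} → p ℕ.≤ m → ℕ→ℚ m ≡ ℕ→ℚ p + ℕ→ℚ (m ℕ.∸ p)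
    split {m} p≤m = trans (cong ℕ→ℚ (sym (ℕP.m+[n∸m]≡n p≤m))) (ℕ→ℚ-+ p (m ℕ.∸ p))
    Pd≤Qd+Pg-in-ℚ : ℕ→ℚ (p ℕ.^ p) * ℕ→ℚ d ≤ ℕ→ℚ (q ℕ.^ p) * ℕ→ℚ d + ℕ→ℚ (p ℕ.^ p) * ℕ→ℚ g
    Pd≤Qd+Pg-in-ℚ = subst₂ _≤_ (ℕ→ℚ-* (p ℕ.^ p) d)
      (trans (ℕ→ℚ-+ (q ℕ.^ p ℕ.* d) (p ℕ.^ p ℕ.* g)) (cong₂ _+_ (ℕ→ℚ-* (q ℕ.^ p) d) (ℕ→ℚ-* (p ℕ.^ p) g)))
      (ℕ→ℚ-mono-≤ Pd≤Qd+Pg)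
    ed≤d+eg : ∀ k → ePartial k * ℕ→ℚ d ≤ ℕ→ℚ d + ePartial k * ℕ→ℚ g
    ed≤d+eg k = *-≤-+-*-cancel {{ℕ→ℚ-pos (p ℕ.^ p) {{ℕP.m^n≢0 p p}}}}
      (ℚP.≤-trans (ℚP.nonNegative⁻¹ 1ℚ) (1≤ePartial k)) (ℕ→ℚ-nonNeg d) Pd≤Qd+Pg-in-ℚ (ePartial-*-^-≤ k q)

module Domination where

  open import Data.Nat using (ℕ; zero; suc; _+_; _*_; _∸_; _≤_; z≤n; s≤s)
  import Data.Nat.Properties as ℕP
  open import Data.Bool using (Bool; _∨_; _∧_)
  import Data.Bool.Properties as BoolP
  open import Algebra.Bundles using (CommutativeMonoid)
  open import Algebra.Properties.CommutativeSemigroup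
    (CommutativeMonoid.commutativeSemigroup BoolP.∨-commutativeMonoid) using (interchange)
  open import Data.Fin using (Fin)
  open import Data.Fin.Subset using (Subset; inside; outside; ⊥; _∪_; ⁅_⁆; _⊆_; _∈_; _∉_; ∣_∣)
  import Data.Fin.Subset.Properties as SubsetP
  open import Data.Vec using ([]; _∷_; lookup; here)
  open import Data.List as List using (List; []; _∷_; length)
  import Data.List.Properties as ListP
  open import Data.Product using (Σ-syntax; _×_; _,_)
  open import Data.Sum using ([_,_]′)
  open import Function using (id; _∘_)
  open import Relation.Nullary using (contradiction; yes; no)
  import Data.Vec.Properties as VecP
  open import Relation.Binary.PropositionalEquality
  open import Defs

  p⊆q⇒p∪q≡q : ∀ {n} {p q : Subset n} → p ⊆ q → p ∪ q ≡ q
  p⊆q⇒p∪q≡q {p = p} {q} p⊆q = SubsetP.⊆-antisym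
    (λ x∈p∪q → [ p⊆q , id ]′ (SubsetP.x∈p∪q⁻ p q x∈p∪q))
    (SubsetP.q⊆p∪q p q)

  ∣p∪r∣+∣q∣≤∣p∣+∣q∪r∣ : ∀ {n} {p q : Subset n} (r : Subset n) → q ⊆ p → ∣ p ∪ r ∣ + ∣ q ∣ ≤ ∣ p ∣ + ∣ q ∪ r ∣
  ∣p∪r∣+∣q∣≤∣p∣+∣q∪r∣ {p = []} {[]} [] _ = z≤n
  ∣p∪r∣+∣q∣≤∣p∣+∣q∪r∣ {p = outside ∷ p} {outside ∷ q} (outside ∷ r) q⊆p = ∣p∪r∣+∣q∣≤∣p∣+∣q∪r∣ r (SubsetP.drop-∷-⊆ q⊆p)
  ∣p∪r∣+∣q∣≤∣p∣+∣q∪r∣ {p = outside ∷ p} {outside ∷ q} (inside ∷ r) q⊆p rewrite ℕP.+-suc ∣ p ∣ ∣ q ∪ r ∣ =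
    s≤s (∣p∪r∣+∣q∣≤∣p∣+∣q∪r∣ r (SubsetP.drop-∷-⊆ q⊆p))
  ∣p∪r∣+∣q∣≤∣p∣+∣q∪r∣ {p = outside ∷ p} {inside ∷ q} r q⊆p with () ← q⊆p here
  ∣p∪r∣+∣q∣≤∣p∣+∣q∪r∣ {p = inside ∷ p} {outside ∷ q} (outside ∷ r) q⊆p = s≤s (∣p∪r∣+∣q∣≤∣p∣+∣q∪r∣ r (SubsetP.drop-∷-⊆ q⊆p))
  ∣p∪r∣+∣q∣≤∣p∣+∣q∪r∣ {p = inside ∷ p} {outside ∷ q} (inside ∷ r) q⊆p =
    s≤s (ℕP.≤-trans (∣p∪r∣+∣q∣≤∣p∣+∣q∪r∣ r (SubsetP.drop-∷-⊆ q⊆p)) (ℕP.+-monoʳ-≤ ∣ p ∣ (ℕP.n≤1+n _)))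
  ∣p∪r∣+∣q∣≤∣p∣+∣q∪r∣ {p = inside ∷ p} {inside ∷ q} (s ∷ r) q⊆p
    rewrite ℕP.+-suc ∣ p ∪ r ∣ ∣ q ∣ | ℕP.+-suc ∣ p ∣ ∣ q ∪ r ∣ =
    s≤s (s≤s (∣p∪r∣+∣q∣≤∣p∣+∣q∪r∣ r (SubsetP.drop-∷-⊆ q⊆p)))

  ∣p∣≡0⇒p≡⊥ : ∀ {n} (p : Subset n) → ∣ p ∣ ≡ 0 → p ≡ ⊥
  ∣p∣≡0⇒p≡⊥ []            _ = refl
  ∣p∣≡0⇒p≡⊥ (outside ∷ p) ∣p∣≡0 = cong (outside ∷_) (∣p∣≡0⇒p≡⊥ p ∣p∣≡0)

  ∣⁅x⁆∪p∣≡1+∣p∣ : ∀ {n} {x : Fin n} (p : Subset n) → x ∉ p → ∣ ⁅ x ⁆ ∪ p ∣ ≡ suc ∣ p ∣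
  ∣⁅x⁆∪p∣≡1+∣p∣ {x = Fin.zero}  (outside ∷ p) _ = cong (suc ∘ ∣_∣) (SubsetP.∪-identityˡ p)
  ∣⁅x⁆∪p∣≡1+∣p∣ {x = Fin.zero}  (inside ∷ p) x∉p = contradiction here x∉p
  ∣⁅x⁆∪p∣≡1+∣p∣ {x = Fin.suc x} (outside ∷ p) x∉p = ∣⁅x⁆∪p∣≡1+∣p∣ p (SubsetP.drop-not-there x∉p)
  ∣⁅x⁆∪p∣≡1+∣p∣ {x = Fin.suc x} (inside ∷ p) x∉p = cong suc (∣⁅x⁆∪p∣≡1+∣p∣ p (SubsetP.drop-not-there x∉p))

  toSubset-[] : ∀ {n} → toSubset {n} [] ≡ ⊥
  toSubset-[] {zero}  = refl
  toSubset-[] {suc n} = cong (outside ∷_) toSubset-[]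

  toSubset-map-suc : ∀ {n} (vs : List (Fin n)) → toSubset (List.map Fin.suc vs) ≡ outside ∷ toSubset vs
  toSubset-map-suc []       = refl
  toSubset-map-suc (v ∷ vs) = cong ((outside ∷ ⁅ v ⁆) ∪_) (toSubset-map-suc vs)

  enumeration : ∀ {n} (A : Subset n) → Σ[ vs ∈ List (Fin n) ] toSubset vs ≡ A × length vs ≡ ∣ A ∣
  enumeration [] = [] , refl , refl
  enumeration (outside ∷ A) with enumeration A
  ... | vs , vs↦A , ∣vs∣≡∣A∣ =
    List.map Fin.suc vs , trans (toSubset-map-suc vs) (cong (outside ∷_) vs↦A) , trans (ListP.length-map Fin.suc vs) ∣vs∣≡∣A∣
  enumeration (inside ∷ A) with enumeration A
  ... | vs , vs↦A , ∣vs∣≡∣A∣ =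
    Fin.zero ∷ List.map Fin.suc vs ,
    trans (cong (⁅ Fin.zero ⁆ ∪_) (toSubset-map-suc vs)) (cong (inside ∷_) (trans (SubsetP.∪-identityˡ _) vs↦A)) ,
    cong suc (trans (ListP.length-map Fin.suc vs) ∣vs∣≡∣A∣)

  anyFin-cong : ∀ {n} {f g : Fin n → Bool} → (∀ i → f i ≡ g i) → anyFin f ≡ anyFin g
  anyFin-cong {zero}  f≗g = refl
  anyFin-cong {suc n} f≗g = cong₂ _∨_ (f≗g Fin.zero) (anyFin-cong (λ i → f≗g (Fin.suc i)))

  anyFin-∨ : ∀ {n} (f g : Fin n → Bool) → anyFin (λ i → f i ∨ g i) ≡ anyFin f ∨ anyFin g
  anyFin-∨ {zero}  f g = refl
  anyFin-∨ {suc n} f g = trans (cong ((f Fin.zero ∨ g Fin.zero) ∨_) (anyFin-∨ (λ i → f (Fin.suc i)) (λ i → g (Fin.suc i))))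
    (interchange (f Fin.zero) (g Fin.zero) (anyFin (λ i → f (Fin.suc i))) (anyFin (λ i → g (Fin.suc i))))

  module _ {n : ℕ} (G : Graph n) where

    closedNbhd-∪ : ∀ X Y → closedNbhd G (X ∪ Y) ≡ closedNbhd G X ∪ closedNbhd G Y
    closedNbhd-∪ X Y = trans (VecP.tabulate-cong pointwise) (VecP.tabulate∘lookup _)
      where
      adjacentTo : Subset n → Fin n → Bool
      adjacentTo A v = anyFin (λ u → lookup A u ∧ adj G u v)
      lookup-∪ : ∀ (A B : Subset n) v → lookup (A ∪ B) v ≡ lookup A v ∨ lookup B v
      lookup-∪ A B v = VecP.lookup-zipWith _∨_ v A B
      adjacentTo-∪ : ∀ v → adjacentTo (X ∪ Y) v ≡ adjacentTo X v ∨ adjacentTo Y v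
      adjacentTo-∪ v = trans
        (anyFin-cong (λ u → trans (cong (_∧ adj G u v) (lookup-∪ X Y u)) (BoolP.∧-distribʳ-∨ (adj G u v) (lookup X u) (lookup Y u))))
        (anyFin-∨ (λ u → lookup X u ∧ adj G u v) (λ u → lookup Y u ∧ adj G u v))
      pointwise : ∀ v → lookup (X ∪ Y) v ∨ adjacentTo (X ∪ Y) v ≡ lookup (closedNbhd G X ∪ closedNbhd G Y) v
      pointwise v = begin
        lookup (X ∪ Y) v ∨ adjacentTo (X ∪ Y) v
          ≡⟨ cong₂ _∨_ (lookup-∪ X Y v) (adjacentTo-∪ v) ⟩
        (lookup X v ∨ lookup Y v) ∨ (adjacentTo X v ∨ adjacentTo Y v)
          ≡⟨ interchange (lookup X v) (lookup Y v) (adjacentTo X v) (adjacentTo Y v) ⟩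
        (lookup X v ∨ adjacentTo X v) ∨ (lookup Y v ∨ adjacentTo Y v)
          ≡⟨ cong₂ _∨_ (VecP.lookup∘tabulate _ v) (VecP.lookup∘tabulate _ v) ⟨
        lookup (closedNbhd G X) v ∨ lookup (closedNbhd G Y) v
          ≡⟨ lookup-∪ (closedNbhd G X) (closedNbhd G Y) v ⟨
        lookup (closedNbhd G X ∪ closedNbhd G Y) v ∎
        where open ≡-Reasoning

    closedNbhd-mono : ∀ {X Y} → X ⊆ Y → closedNbhd G X ⊆ closedNbhd G Y
    closedNbhd-mono {X} {Y} X⊆Y = subst (closedNbhd G X ⊆_)
      (trans (sym (closedNbhd-∪ X Y)) (cong (closedNbhd G) (p⊆q⇒p∪q≡q X⊆Y)))
      (SubsetP.p⊆p∪q (closedNbhd G Y))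

    dom-mono : ∀ {X Y} → X ⊆ Y → dom G X ≤ dom G Y
    dom-mono X⊆Y = SubsetP.p⊆q⇒∣p∣≤∣q∣ (closedNbhd-mono X⊆Y)

    dom-submodular : ∀ {S X} (R : Subset n) → S ⊆ X → dom G (X ∪ R) + dom G S ≤ dom G X + dom G (S ∪ R)
    dom-submodular {S} {X} R S⊆X
      rewrite closedNbhd-∪ X R | closedNbhd-∪ S R =
      ∣p∪r∣+∣q∣≤∣p∣+∣q∪r∣ (closedNbhd G R) (closedNbhd-mono S⊆X)

    module _ (S : Subset n) {δ : ℕ} (marginal≤δ : ∀ u → dom G (S ∪ ⁅ u ⁆) ≤ dom G S + δ) where

      dom-∪-toSubset-≤ : ∀ vs → dom G (S ∪ toSubset vs) ≤ dom G S + length vs * δ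
      dom-∪-toSubset-≤ [] = ℕP.≤-reflexive (begin-equality
        dom G (S ∪ toSubset []) ≡⟨ cong (λ T → dom G (S ∪ T)) toSubset-[] ⟩
        dom G (S ∪ ⊥)           ≡⟨ cong (dom G) (SubsetP.∪-identityʳ S) ⟩
        dom G S                 ≡⟨ ℕP.+-identityʳ (dom G S) ⟨
        dom G S + 0             ∎)
        where open ℕP.≤-Reasoning
      dom-∪-toSubset-≤ (v ∷ vs) = begin
        dom G (S ∪ (⁅ v ⁆ ∪ T))       ≡⟨ cong (dom G) (S∪[v∪T]≡[S∪T]∪v) ⟩
        dom G ((S ∪ T) ∪ ⁅ v ⁆)       ≤⟨ marginal-on-S∪T ⟩
        dom G (S ∪ T) + δ             ≤⟨ ℕP.+-monoˡ-≤ δ (dom-∪-toSubset-≤ vs) ⟩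
        dom G S + length vs * δ + δ   ≡⟨ ℕP.+-assoc (dom G S) (length vs * δ) δ ⟩
        dom G S + (length vs * δ + δ) ≡⟨ cong (dom G S +_) (ℕP.+-comm (length vs * δ) δ) ⟩
        dom G S + suc (length vs) * δ ∎
        where
        open ℕP.≤-Reasoning
        T = toSubset vs
        S∪[v∪T]≡[S∪T]∪v : S ∪ (⁅ v ⁆ ∪ T) ≡ (S ∪ T) ∪ ⁅ v ⁆
        S∪[v∪T]≡[S∪T]∪v = trans (cong (S ∪_) (SubsetP.∪-comm ⁅ v ⁆ T)) (sym (SubsetP.∪-assoc S T ⁅ v ⁆))
        marginal-on-S∪T : dom G ((S ∪ T) ∪ ⁅ v ⁆) ≤ dom G (S ∪ T) + δ
        marginal-on-S∪T = ℕP.+-cancelʳ-≤ (dom G S) _ _ (begin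
          dom G ((S ∪ T) ∪ ⁅ v ⁆) + dom G S ≤⟨ dom-submodular {S} ⁅ v ⁆ (SubsetP.p⊆p∪q T) ⟩
          dom G (S ∪ T) + dom G (S ∪ ⁅ v ⁆) ≤⟨ ℕP.+-monoʳ-≤ (dom G (S ∪ T)) (marginal≤δ v) ⟩
          dom G (S ∪ T) + (dom G S + δ)     ≡⟨ cong (dom G (S ∪ T) +_) (ℕP.+-comm (dom G S) δ) ⟩
          dom G (S ∪ T) + (δ + dom G S)     ≡⟨ ℕP.+-assoc (dom G (S ∪ T)) δ (dom G S) ⟨
          dom G (S ∪ T) + δ + dom G S       ∎)

      dom-≤-+-∣∣* : ∀ A → dom G A ≤ dom G S + ∣ A ∣ * δ
      dom-≤-+-∣∣* A with enumeration A
      ... | vs , refl , ∣vs∣≡∣A∣ = begin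
        dom G (toSubset vs)           ≤⟨ dom-mono (SubsetP.q⊆p∪q S (toSubset vs)) ⟩
        dom G (S ∪ toSubset vs)       ≤⟨ dom-∪-toSubset-≤ vs ⟩
        dom G S + length vs * δ       ≡⟨ cong (λ m → dom G S + m * δ) ∣vs∣≡∣A∣ ⟩
        dom G S + ∣ toSubset vs ∣ * δ ∎
        where open ℕP.≤-Reasoning

    greedy-choice-maximal : ∀ {S v} → (∀ w → w ∉ S → dom G (S ∪ ⁅ w ⁆) ≤ dom G (S ∪ ⁅ v ⁆)) →
                        ∀ u → dom G (S ∪ ⁅ u ⁆) ≤ dom G (S ∪ ⁅ v ⁆)
    greedy-choice-maximal {S} {v} greedy u with u SubsetP.∈? S
    ... | no  u∉S = greedy u u∉S
    ... | yes u∈S = begin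
      dom G (S ∪ ⁅ u ⁆) ≡⟨ cong (dom G) (trans (SubsetP.∪-comm S ⁅ u ⁆) (p⊆q⇒p∪q≡q ⁅u⁆⊆S)) ⟩
      dom G S           ≤⟨ dom-mono {S} (SubsetP.p⊆p∪q ⁅ v ⁆) ⟩
      dom G (S ∪ ⁅ v ⁆) ∎
      where
      open ℕP.≤-Reasoning
      ⁅u⁆⊆S : ⁅ u ⁆ ⊆ S
      ⁅u⁆⊆S x∈⁅u⁆ = subst (_∈ S) (sym (SubsetP.x∈⁅y⁆⇒x≡y u x∈⁅u⁆)) u∈S

    ∣toSubset∣≡length : ∀ {vs} → GreedyRun G vs → ∣ toSubset vs ∣ ≡ length vs
    ∣toSubset∣≡length start = trans (cong ∣_∣ (toSubset-[] {n})) (SubsetP.∣⊥∣≡0 n)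
    ∣toSubset∣≡length (step v run v∉S _) = trans (∣⁅x⁆∪p∣≡1+∣p∣ _ v∉S) (cong suc (∣toSubset∣≡length run))

module GreedyProgress where

  open import Data.Nat using (ℕ; zero; suc; _+_; _*_; _∸_; _^_; _≤_; z≤n; s≤s)
  import Data.Nat.Properties as ℕP
  open import Data.Nat.Solver using (module +-*-Solver)
  open import Relation.Binary.PropositionalEquality
  open import Defs using (eRatio*_≤_)
  open EulerRatio using (eRatio*-of-≤-double; eRatio*-of-geometric)

  open +-*-Solver

  geometric-step : ∀ q {i d g δ} → let p = suc q in
    p ^ i * d ≤ q ^ i * d + p ^ i * g → d ≤ g + p * δ →
    p ^ suc i * d ≤ q ^ suc i * d + p ^ suc i * (g + δ)
  geometric-step q {i} {d} {g} {δ} Pd≤Qd+Pg d≤g+pδ = subst₂ _≤_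
    (solve 3 (λ q P d → P :* d :+ q :* (P :* d) := (con 1 :+ q) :* P :* d) refl q P d)
    (solve 6 (λ q P Q d g δ → P :* (g :+ (con 1 :+ q) :* δ) :+ q :* (Q :* d :+ P :* g)
                            := q :* Q :* d :+ (con 1 :+ q) :* P :* (g :+ δ)) refl q P Q d g δ)
    (ℕP.+-mono-≤ (ℕP.*-monoʳ-≤ P d≤g+pδ) (ℕP.*-monoʳ-≤ q Pd≤Qd+Pg))
    where
    P = suc q ^ i
    Q = q ^ i

  module _ (q d : ℕ) where

    private
      p = suc q

    -- The state after i greedy steps with g = dom A_i: the classical bound together with g ≥ 2i
    -- (every step so far gained two vertices), or the bound left by a step that gained exactly one
    -- vertex, or domination of at least d vertices.
    data Progress (i g : ℕ) : Set where
      geometric : i + i ≤ g → p ^ i * d ≤ q ^ i * d + p ^ i * g → Progress i g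
      linear    : i ≤ g → d ≤ p + ((g ∸ i) + (g ∸ i)) → Progress i g
      covered   : d ≤ g → Progress i g

    progress-start : ∀ g → Progress 0 g
    progress-start g = geometric z≤n (ℕP.m≤m+n (1 * d) (1 * g))

    progress-step : ∀ {i g} δ → Progress i g → d ≤ g + p * δ → Progress (suc i) (g + δ)
    progress-step {g = g} zero _ d≤g+pδ = covered (begin
      d         ≤⟨ d≤g+pδ ⟩
      g + p * 0 ≡⟨ cong (g +_) (ℕP.*-zeroʳ p) ⟩
      g + 0     ∎)
      where open ℕP.≤-Reasoning
    progress-step {i} {g} (suc zero) (geometric 2i≤g _) d≤g+p = linear
      (ℕP.≤-trans (s≤s (ℕP.≤-trans (ℕP.m≤m+n i i) 2i≤g)) (ℕP.≤-reflexive (ℕP.+-comm 1 g)))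
      (begin
        d                                  ≤⟨ d≤g+p ⟩
        g + p * 1                          ≡⟨ trans (cong (g +_) (ℕP.*-identityʳ p)) (ℕP.+-comm g p) ⟩
        p + g                              ≤⟨ ℕP.+-monoʳ-≤ p g≤2[g∸i] ⟩
        p + ((g ∸ i) + (g ∸ i))            ≡⟨ cong (λ m → p + ((m ∸ suc i) + (m ∸ suc i))) (ℕP.+-comm 1 g) ⟩
        p + ((g + 1 ∸ suc i) + (g + 1 ∸ suc i)) ∎)
      where
      open ℕP.≤-Reasoning
      g≤2[g∸i] : g ≤ (g ∸ i) + (g ∸ i)
      g≤2[g∸i] = begin
        g                   ≡⟨ ℕP.m+[n∸m]≡n (ℕP.≤-trans (ℕP.m≤m+n i i) 2i≤g) ⟨
        i + (g ∸ i)         ≤⟨ ℕP.+-monoˡ-≤ (g ∸ i) (ℕP.m+n≤o⇒m≤o∸n i 2i≤g) ⟩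
        (g ∸ i) + (g ∸ i)   ∎
    progress-step {i} {g} (suc (suc δ)) (geometric 2i≤g Pd≤Qd+Pg) d≤g+pδ =
      geometric 2[i+1]≤g+δ (geometric-step q {i} Pd≤Qd+Pg d≤g+pδ)
      where
      2[i+1]≤g+δ : suc i + suc i ≤ g + suc (suc δ)
      2[i+1]≤g+δ rewrite ℕP.+-suc i i | ℕP.+-suc g (suc δ) | ℕP.+-suc g δ =
        s≤s (s≤s (ℕP.≤-trans 2i≤g (ℕP.m≤m+n g δ)))
    progress-step {i} {g} (suc δ) (linear i≤g d≤p+2[g∸i]) _ rewrite ℕP.+-suc g δ =
      linear (s≤s (ℕP.≤-trans i≤g (ℕP.m≤m+n g δ)))
        (ℕP.≤-trans d≤p+2[g∸i] (ℕP.+-monoʳ-≤ p (ℕP.+-mono-≤ g∸i≤g+δ∸i g∸i≤g+δ∸i)))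
      where
      g∸i≤g+δ∸i : g ∸ i ≤ g + δ ∸ i
      g∸i≤g+δ∸i = ℕP.∸-monoˡ-≤ i (ℕP.m≤m+n g δ)
    progress-step δ (covered d≤g) _ = covered (ℕP.≤-trans d≤g (ℕP.m≤m+n _ δ))

    progress-end : ∀ {g} → Progress p g → eRatio* (d ∸ p) ≤ (g ∸ p)
    progress-end (geometric 2p≤g Pd≤Qd+Pg) = eRatio*-of-geometric q Pd≤Qd+Pg 2p≤g
    progress-end {g} (linear _ d≤p+2[g∸p]) = eRatio*-of-≤-double {y = g ∸ p} (ℕP.m≤n+o⇒m∸n≤o d p d≤p+2[g∸p])
    progress-end {g} (covered d≤g) =
      eRatio*-of-≤-double {y = g ∸ p} (ℕP.≤-trans (ℕP.∸-monoˡ-≤ p d≤g) (ℕP.m≤m+n (g ∸ p) (g ∸ p)))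

open import Defs
open import Data.Nat using (ℕ; _≤_)
open import Data.List using (List; length)
open import Data.Fin using (Fin)
open import Data.Fin.Subset using (Subset; ∣_∣)
open import Relation.Binary.PropositionalEquality using (_≡_)

open import Data.Nat using (zero; suc; _+_; _*_; _∸_)
import Data.Nat.Properties as ℕP
open import Data.List using (_∷_)
open import Data.Fin.Subset using (_∪_; ⁅_⁆; _⊆_)
import Data.Fin.Subset.Properties as SubsetP
open import Relation.Binary.PropositionalEquality using (subst; sym; trans; cong)
open EulerRatio using (eRatio*-of-≤-double)
open Domination using (dom-mono; dom-≤-+-∣∣*; greedy-choice-maximal; ∣toSubset∣≡length; ∣p∣≡0⇒p≡⊥)
open GreedyProgress using (Progress; progress-start; progress-step; progress-end)

module _ {n} (G : Graph n) (A : Subset n) (q : ℕ) (∣A∣≡1+q : ∣ A ∣ ≡ suc q) where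

  greedy-progress : ∀ {vs} → GreedyRun G vs → Progress q (dom G A) (length vs) (dom G (toSubset vs))
  greedy-progress start = progress-start q (dom G A) _
  greedy-progress {v ∷ vs} (step v run _ greedy) =
    subst (Progress q (dom G A) (suc (length vs))) (trans g+δ≡g′ (cong (dom G) (SubsetP.∪-comm S ⁅ v ⁆)))
      (progress-step q (dom G A) δ (greedy-progress run) d≤g+pδ)
    where
    S = toSubset vs
    g = dom G S
    δ = dom G (S ∪ ⁅ v ⁆) ∸ g
    g+δ≡g′ : g + δ ≡ dom G (S ∪ ⁅ v ⁆)
    g+δ≡g′ = ℕP.m+[n∸m]≡n (dom-mono G {S} (SubsetP.p⊆p∪q ⁅ v ⁆))
    d≤g+pδ : dom G A ≤ g + suc q * δ
    d≤g+pδ = subst (λ m → dom G A ≤ g + m * δ) ∣A∣≡1+q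
      (dom-≤-+-∣∣* G S (λ u → subst (dom G (S ∪ ⁅ u ⁆) ≤_) (sym g+δ≡g′) (greedy-choice-maximal G {S} greedy u)) A)

corollary4p1 : (n : ℕ) (G : Graph n) (p : ℕ) → p ≤ n →
    (vs : List (Fin n)) → GreedyRun G vs → length vs ≡ p →
    (A : Subset n) → ∣ A ∣ ≡ p →
    eRatio* ext G A ≤ ext G (toSubset vs)
corollary4p1 n G zero _ vs run ∣vs∣≡0 A ∣A∣≡0
  rewrite ∣A∣≡0 | ∣toSubset∣≡length G run | ∣vs∣≡0 =
  eRatio*-of-≤-double {y = dom G (toSubset vs)} (ℕP.≤-trans (dom-mono G A⊆T) (ℕP.m≤m+n _ _))
  where
  A⊆T : A ⊆ toSubset vs
  A⊆T = subst (_⊆ toSubset vs) (sym (∣p∣≡0⇒p≡⊥ A ∣A∣≡0)) (SubsetP.⊆-min (toSubset vs))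
corollary4p1 n G (suc q) _ vs run ∣vs∣≡p A ∣A∣≡p
  rewrite ∣A∣≡p | ∣toSubset∣≡length G run | ∣vs∣≡p =
  progress-end q (dom G A) (subst (λ i → Progress q (dom G A) i (dom G (toSubset vs))) ∣vs∣≡p (greedy-progress G A q ∣A∣≡p run))
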